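{- For all non-constant homogeneous $f,g\in\mathrm{QSym}$, $\mathrm{MinOne}(f\cdot g)=\mathrm{MaxOne}(f\cdot g)=0$.
   Context: $\mathrm{QSym}$ is the algebra of quasisymmetric functions over $\mathbb{C}$ with fundamental basis $L_\alpha$ (indexed by compositions $\alpha$ of $n$). $\mathrm{MinOne}$ and $\mathrm{MaxOne}$ are the linear functionals with $\mathrm{MinOne}(L_\alpha)=(-1)^k$ if $\alpha=(1^k,n-k)$ for some $0\le k<n$ and $0$ otherwise, and $\mathrm{MaxOne}(L_\alpha)=(-1)^k$ if $\alpha=(n-k,1^k)$ for some $0\le k<n$ and $0$ otherwise. -}

module Defs where

open import Level using (Level)
open import Data.Nat using (ℕ; zero; suc) renaming (_+_ to _+ℕ_)
open import Data.Bool using (Bool; true; false)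
open import Data.Bool.Properties using () renaming (_≟_ to _≟B_)
open import Data.Product using (_×_; _,_)
open import Data.List using (List; []; _∷_; [_]; _++_; map; foldr; reverse; _∷ʳ_; concatMap)
open import Data.List.Properties using (≡-dec)
open import Data.Vec using (Vec; toList)
import Data.Vec as V
open import Relation.Nullary using (yes; no)
open import Algebra.Bundles using (CommutativeRing)

-- A composition α of N = suc n is encoded by its descent
-- set D(α) = {α₁, α₁+α₂, …} ⊆ {1,…,n}, as a vector of n booleans
-- (entry i true iff i+1 ∈ D(α)).

Comp : ℕ → Set
Comp n = Vec Bool n          -- compositions of suc n

allComp : (n : ℕ) → List (Comp n)
allComp zero    = [ V.[] ]
allComp (suc n) = map (true V.∷_) (allComp n) ++ map (false V.∷_) (allComp n)

shuffles : {A : Set} → List A → List A → List (List A)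
shuffles []       ys       = [ ys ]
shuffles (x ∷ xs) []       = [ x ∷ xs ]
shuffles (x ∷ xs) (y ∷ ys) =
  map (x ∷_) (shuffles xs (y ∷ ys)) ++ map (y ∷_) (shuffles (x ∷ xs) ys)

-- A letter of the shuffled word remembers which word it came from
-- (false = first word u, whose letters are 1..N; true = second word v,
-- whose letters are N+1..N+M, all larger) and whether in its own word it
-- is followed by a smaller letter (a descent).  For u we take any
-- permutation of [N] with descent set D(α), for v one of [N+1..N+M] with
-- descent set D(β).  The descent set of a shuffle w is then determined:
--   u-letter then u-letter : descent iff descent in u (they are adjacent in u)
--   v-letter then v-letter : descent iff descent in v
--   u-letter then v-letter : never (u < v)
--   v-letter then u-letter : always.
Letter : Set
Letter = Bool × Bool

word : Bool → {n : ℕ} → Comp n → List Letter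
word src S = map (src ,_) (toList S ∷ʳ false)

descAt : Letter → Letter → Bool
descAt (false , fa) (false , _) = fa
descAt (true  , fa) (true  , _) = fa
descAt (false , _)  (true  , _) = false
descAt (true  , _)  (false , _) = true

Des : List Letter → List Bool
Des (a ∷ b ∷ w) = descAt a b ∷ Des (b ∷ w)
Des _           = []

module _ {c ℓ : Level} (R : CommutativeRing c ℓ) where
  open CommutativeRing R

  sumR : List Carrier → Carrier
  sumR = foldr _+_ 0#

  -- homogeneous element of degree suc n: f = Σ_α f(α) L_α
  Hom : ℕ → Set c
  Hom n = Comp n → Carrier

  -- L_α · L_β = Σ_{w ∈ u ⧢ v} L_{Des(w)}, extended bilinearly.
  mul : {n m : ℕ} → Hom n → Hom m → Hom (suc (n +ℕ m))
  mul {n} {m} f g U =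
    sumR (concatMap (λ S → concatMap (λ T →
      map (λ w → coeff (Des w) S T) (shuffles (word false S) (word true T)))
      (allComp m)) (allComp n))
    where
      coeff : List Bool → Comp n → Comp m → Carrier
      coeff d S T with ≡-dec _≟B_ d (toList U)
      ... | yes _ = f S * g T
      ... | no  _ = 0#

  -- value on the composition with descent list d:
  -- MinOne(L_α) = (-1)^k if α = (1^k, N-k), i.e. d = true^k false^(N-1-k)
  minOneCoeff : List Bool → Carrier
  minOneCoeff []           = 1#
  minOneCoeff (true ∷ d)   = - minOneCoeff d
  minOneCoeff (false ∷ d)  = allFalse d
    where
      allFalse : List Bool → Carrier
      allFalse []          = 1#
      allFalse (false ∷ e) = allFalse e
      allFalse (true ∷ _)  = 0#

  -- MaxOne(L_α) = (-1)^k if α = (N-k, 1^k), i.e. d = false^(N-1-k) true^k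
  maxOneCoeff : List Bool → Carrier
  maxOneCoeff d = minOneCoeff (reverse d)

  MinOne : {n : ℕ} → Hom n → Carrier
  MinOne {n} h = sumR (map (λ U → minOneCoeff (toList U) * h U) (allComp n))

  MaxOne : {n : ℕ} → Hom n → Carrier
  MaxOne {n} h = sumR (map (λ U → maxOneCoeff (toList U) * h U) (allComp n))

{-# OPTIONS --safe #-}
-- Both functionals are instances of the hook functional h_{a,b}, with h_{a,b}(L_α) = a^j b^k
-- when α = (1^j, k+1) and 0 otherwise: MinOne = h_{-1,1}, and MaxOne is h_{1,-1} evaluated
-- on the complemented descent set.  Expanding f·g in the basis L reduces the claim to
-- Σ_{w ∈ u ⧢ v} h_{a,b}(Des w) = 0 when a + b = 0, for nonempty words u, v with every
-- letter of u below every letter of v.  Splitting the shuffles by their first letter, those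
-- starting in u contribute b·C and those starting in v contribute a·C for one and the same C,
-- so the sum is (a + b)·C.  For MaxOne, complementing all values exchanges u and v and
-- complements every descent set.
module Submission where

open import Defs
open import Level using (Level)
open import Data.Nat using (ℕ; zero; suc; pred) renaming (_+_ to _+ℕ_)
import Data.Nat.Properties as ℕ
open import Data.Product using (_×_; _,_)
open import Data.Bool using (Bool; true; false; not; if_then_else_)
open import Data.Bool.Properties using () renaming (_≟_ to _≟B_)
open import Data.List using (List; []; _∷_; _++_; map; reverse; _∷ʳ_; concatMap; length)
open import Data.List.Properties
  using (≡-dec; map-++; map-∘; length-++; length-map; unfold-reverse; reverse-map)
open import Data.List.Relation.Unary.All using (All; []; _∷_)
import Data.List.Relation.Unary.All as All
open import Data.List.Relation.Unary.All.Properties using (++⁺; map⁺)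
open import Data.Vec using (toList)
import Data.Vec as V
open import Data.Vec.Properties using (length-toList)
open import Function using (_∘_)
open import Relation.Nullary using (does; yes; no)
open import Relation.Binary.PropositionalEquality as ≡ using (_≡_; cong; cong₂)
open import Algebra.Bundles using (CommutativeRing)
import Algebra.Properties.Ring as RingProperties
import Algebra.Properties.CommutativeSemigroup as CommutativeSemigroupProperties

shuffles-length : {A : Set} (xs ys : List A) →
                  All (λ w → length w ≡ length xs +ℕ length ys) (shuffles xs ys)
shuffles-length []       ys       = ≡.refl ∷ []
shuffles-length (x ∷ xs) []       = cong suc (≡.sym (ℕ.+-identityʳ (length xs))) ∷ []
shuffles-length (x ∷ xs) (y ∷ ys) =
  ++⁺ (map⁺ (All.map (cong suc) (shuffles-length xs (y ∷ ys))))
      (map⁺ (All.map (λ eq → ≡.trans (cong suc eq) (≡.sym (ℕ.+-suc (length (x ∷ xs)) (length ys))))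
                     (shuffles-length (x ∷ xs) ys)))

Des-length : (w : List Letter) → length (Des w) ≡ pred (length w)
Des-length []          = ≡.refl
Des-length (_ ∷ [])    = ≡.refl
Des-length (_ ∷ y ∷ w) = cong suc (Des-length (y ∷ w))

word-length : (src : Bool) {n : ℕ} (S : Comp n) → length (word src S) ≡ suc n
word-length src {n} S = begin
  length (word src S)          ≡⟨ length-map (src ,_) (toList S ∷ʳ false) ⟩
  length (toList S ∷ʳ false)   ≡⟨ length-++ (toList S) ⟩
  length (toList S) +ℕ 1       ≡⟨ cong (_+ℕ 1) (length-toList S) ⟩
  n +ℕ 1                       ≡⟨ ℕ.+-comm n 1 ⟩
  suc n                        ∎
  where open ≡.≡-Reasoning

wordShuffles : {n m : ℕ} → Comp n → Comp m → List (List Letter)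
wordShuffles S T = shuffles (word false S) (word true T)

Des-wordShuffles-length : {n m : ℕ} (S : Comp n) (T : Comp m) →
  All (λ w → length (Des w) ≡ suc (n +ℕ m)) (wordShuffles S T)
Des-wordShuffles-length {n} {m} S T =
  All.map (λ {w} → length-Des w) (shuffles-length (word false S) (word true T))
  where
  open ≡.≡-Reasoning
  length-Des : (w : List Letter) → length w ≡ length (word false S) +ℕ length (word true T) →
               length (Des w) ≡ suc (n +ℕ m)
  length-Des w eq = begin
    length (Des w)                                        ≡⟨ Des-length w ⟩
    pred (length w)                                       ≡⟨ cong pred eq ⟩
    pred (length (word false S) +ℕ length (word true T))  ≡⟨ cong₂ (λ i j → pred (i +ℕ j))
                                                               (word-length false S) (word-length true T) ⟩
    n +ℕ suc m                                            ≡⟨ ℕ.+-suc n m ⟩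
    suc (n +ℕ m)                                          ∎

lower upper : List Bool → List Letter
lower = map (false ,_)
upper = map (true ,_)

-- The value complement i ↦ N + M + 1 − i, which exchanges the smaller and the larger word.
complement : Letter → Letter
complement (src , f) = not src , not f

descAt-complement : (x y : Letter) → descAt (complement x) (complement y) ≡ not (descAt x y)
descAt-complement (false , _) (false , _) = ≡.refl
descAt-complement (false , _) (true  , _) = ≡.refl
descAt-complement (true  , _) (false , _) = ≡.refl
descAt-complement (true  , _) (true  , _) = ≡.refl

Des-complement : (w : List Letter) → Des (map complement w) ≡ map not (Des w)
Des-complement []          = ≡.refl
Des-complement (_ ∷ [])    = ≡.refl
Des-complement (x ∷ y ∷ w) = cong₂ _∷_ (descAt-complement x y) (Des-complement (y ∷ w))

complement-lower : (ps : List Bool) → map complement (lower ps) ≡ upper (map not ps)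
complement-lower []       = ≡.refl
complement-lower (p ∷ ps) = cong (_ ∷_) (complement-lower ps)

complement-upper : (qs : List Bool) → map complement (upper qs) ≡ lower (map not qs)
complement-upper []       = ≡.refl
complement-upper (q ∷ qs) = cong (_ ∷_) (complement-upper qs)

module _ {c ℓ : Level} (R : CommutativeRing c ℓ) where
  open CommutativeRing R
  open RingProperties ring using (-1*x≈-x)
  open CommutativeSemigroupProperties *-commutativeSemigroup using (x∙yz≈y∙xz)
  open import Relation.Binary.Reasoning.Setoid setoid

  private variable A B : Set

  ∑ : (A → Carrier) → List A → Carrier
  ∑ h l = sumR R (map h l)

  ∑-cong : {h k : A → Carrier} → (∀ x → h x ≈ k x) → (l : List A) → ∑ h l ≈ ∑ k l
  ∑-cong e []      = refl
  ∑-cong e (x ∷ l) = +-cong (e x) (∑-cong e l)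

  ∑-congᴬ : {h k : A → Carrier} {l : List A} → All (λ x → h x ≈ k x) l → ∑ h l ≈ ∑ k l
  ∑-congᴬ []       = refl
  ∑-congᴬ (e ∷ es) = +-cong e (∑-congᴬ es)

  ∑-vanishes : {h : A → Carrier} → (∀ x → h x ≈ 0#) → (l : List A) → ∑ h l ≈ 0#
  ∑-vanishes e []      = refl
  ∑-vanishes e (x ∷ l) = trans (+-cong (e x) (∑-vanishes e l)) (+-identityʳ 0#)

  sumR-++ : (xs ys : List Carrier) → sumR R (xs ++ ys) ≈ sumR R xs + sumR R ys
  sumR-++ []       ys = sym (+-identityˡ _)
  sumR-++ (x ∷ xs) ys = trans (+-congˡ (sumR-++ xs ys)) (sym (+-assoc _ _ _))

  ∑-++ : (h : A → Carrier) (xs ys : List A) → ∑ h (xs ++ ys) ≈ ∑ h xs + ∑ h ys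
  ∑-++ h xs ys = trans (reflexive (cong (sumR R) (map-++ h xs ys))) (sumR-++ (map h xs) (map h ys))

  ∑-map : (h : B → Carrier) (g : A → B) (l : List A) → ∑ h (map g l) ≡ ∑ (h ∘ g) l
  ∑-map h g l = cong (sumR R) (≡.sym (map-∘ l))

  sumR-concatMap : (h : A → List Carrier) (l : List A) →
                   sumR R (concatMap h l) ≈ ∑ (sumR R ∘ h) l
  sumR-concatMap h []      = refl
  sumR-concatMap h (x ∷ l) = trans (sumR-++ (h x) (concatMap h l)) (+-congˡ (sumR-concatMap h l))

  *-∑ : (a : Carrier) (h : A → Carrier) (l : List A) → a * ∑ h l ≈ ∑ (λ x → a * h x) l
  *-∑ a h []      = zeroʳ a
  *-∑ a h (x ∷ l) = trans (distribˡ a _ _) (+-congˡ (*-∑ a h l))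

  ∑-scale : (x : Carrier) (h : A → Carrier) (l : List A) {y : Carrier} →
            ∑ h l ≈ y → ∑ (λ w → x * h w) l ≈ x * y
  ∑-scale x h l e = trans (sym (*-∑ x h l)) (*-congˡ e)

  ∑-scale-vanishes : (x : Carrier) (h : A → Carrier) (l : List A) →
                     ∑ h l ≈ 0# → ∑ (λ w → x * h w) l ≈ 0#
  ∑-scale-vanishes x h l e = trans (∑-scale x h l e) (zeroʳ x)

  ∑-+ : (h k : A → Carrier) (l : List A) → ∑ h l + ∑ k l ≈ ∑ (λ x → h x + k x) l
  ∑-+ h k []      = +-identityˡ 0#
  ∑-+ h k (x ∷ l) = begin
    (h x + ∑ h l) + (k x + ∑ k l)   ≈⟨ +-assoc _ _ _ ⟩
    h x + (∑ h l + (k x + ∑ k l))   ≈⟨ +-congˡ (trans (+-comm _ _) (+-assoc _ _ _)) ⟩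
    h x + (k x + (∑ k l + ∑ h l))   ≈⟨ sym (+-assoc _ _ _) ⟩
    (h x + k x) + (∑ k l + ∑ h l)   ≈⟨ +-congˡ (trans (+-comm _ _) (∑-+ h k l)) ⟩
    (h x + k x) + ∑ (λ y → h y + k y) l ∎

  ∑-comm : (F : A → B → Carrier) (l₁ : List A) (l₂ : List B) →
           ∑ (λ x → ∑ (F x) l₂) l₁ ≈ ∑ (λ y → ∑ (λ x → F x y) l₁) l₂
  ∑-comm F []       l₂ = sym (∑-vanishes (λ _ → refl) l₂)
  ∑-comm F (x ∷ l₁) l₂ = trans (+-congˡ (∑-comm F l₁ l₂)) (∑-+ (F x) _ l₂)

  ∑-shuffles-∷ : (h : List A → Carrier) (x : A) (xs : List A) (y : A) (ys : List A) →
                 ∑ h (shuffles (x ∷ xs) (y ∷ ys))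
                 ≈ ∑ (h ∘ (x ∷_)) (shuffles xs (y ∷ ys)) + ∑ (h ∘ (y ∷_)) (shuffles (x ∷ xs) ys)
  ∑-shuffles-∷ h x xs y ys =
    trans (∑-++ h (map (x ∷_) (shuffles xs (y ∷ ys))) (map (y ∷_) (shuffles (x ∷ xs) ys)))
          (reflexive (cong₂ _+_ (∑-map h (x ∷_) (shuffles xs (y ∷ ys)))
                                (∑-map h (y ∷_) (shuffles (x ∷ xs) ys))))

  ∑-shuffles-comm : (h : List A → Carrier) (xs ys : List A) →
                    ∑ h (shuffles xs ys) ≈ ∑ h (shuffles ys xs)
  ∑-shuffles-comm h []       []       = refl
  ∑-shuffles-comm h []       (y ∷ ys) = refl
  ∑-shuffles-comm h (x ∷ xs) []       = refl
  ∑-shuffles-comm h (x ∷ xs) (y ∷ ys) = begin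
    ∑ h (shuffles (x ∷ xs) (y ∷ ys))
      ≈⟨ ∑-shuffles-∷ h x xs y ys ⟩
    ∑ (h ∘ (x ∷_)) (shuffles xs (y ∷ ys)) + ∑ (h ∘ (y ∷_)) (shuffles (x ∷ xs) ys)
      ≈⟨ +-comm _ _ ⟩
    ∑ (h ∘ (y ∷_)) (shuffles (x ∷ xs) ys) + ∑ (h ∘ (x ∷_)) (shuffles xs (y ∷ ys))
      ≈⟨ +-cong (∑-shuffles-comm _ (x ∷ xs) ys) (∑-shuffles-comm _ xs (y ∷ ys)) ⟩
    ∑ (h ∘ (y ∷_)) (shuffles ys (x ∷ xs)) + ∑ (h ∘ (x ∷_)) (shuffles (y ∷ ys) xs)
      ≈⟨ sym (∑-shuffles-∷ h y ys x xs) ⟩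
    ∑ h (shuffles (y ∷ ys) (x ∷ xs)) ∎

  ∑-shuffles-map : (h : List B → Carrier) (f : A → B) (xs ys : List A) →
                   ∑ h (shuffles (map f xs) (map f ys)) ≈ ∑ (h ∘ map f) (shuffles xs ys)
  ∑-shuffles-map h f []       ys       = refl
  ∑-shuffles-map h f (x ∷ xs) []       = refl
  ∑-shuffles-map h f (x ∷ xs) (y ∷ ys) = begin
    ∑ h (shuffles (map f (x ∷ xs)) (map f (y ∷ ys)))
      ≈⟨ ∑-shuffles-∷ h (f x) (map f xs) (f y) (map f ys) ⟩
    ∑ (h ∘ (f x ∷_)) (shuffles (map f xs) (map f (y ∷ ys)))
      + ∑ (h ∘ (f y ∷_)) (shuffles (map f (x ∷ xs)) (map f ys))
      ≈⟨ +-cong (∑-shuffles-map _ f xs (y ∷ ys)) (∑-shuffles-map _ f (x ∷ xs) ys) ⟩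
    ∑ (h ∘ map f ∘ (x ∷_)) (shuffles xs (y ∷ ys)) + ∑ (h ∘ map f ∘ (y ∷_)) (shuffles (x ∷ xs) ys)
      ≈⟨ sym (∑-shuffles-∷ (h ∘ map f) x xs y ys) ⟩
    ∑ (h ∘ map f) (shuffles (x ∷ xs) (y ∷ ys)) ∎

  row : Carrier → List Bool → Carrier
  row b []          = 1#
  row b (false ∷ d) = b * row b d
  row b (true  ∷ d) = 0#

  hook : Carrier → Carrier → List Bool → Carrier
  hook a b []          = 1#
  hook a b (true  ∷ d) = a * hook a b d
  hook a b (false ∷ d) = row b (false ∷ d)

  minOneCoeff≈hook : (d : List Bool) → minOneCoeff R d ≈ hook (- 1#) 1# d
  minOneCoeff≈hook []          = refl
  minOneCoeff≈hook (true  ∷ d) = trans (-‿cong (minOneCoeff≈hook d)) (sym (-1*x≈-x _))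
  minOneCoeff≈hook (false ∷ d) = minOneCoeff-false∷≈row d
    where
    minOneCoeff-false∷≈row : (e : List Bool) → minOneCoeff R (false ∷ e) ≈ row 1# (false ∷ e)
    minOneCoeff-false∷≈row []          = sym (*-identityˡ 1#)
    minOneCoeff-false∷≈row (false ∷ e) = trans (minOneCoeff-false∷≈row e) (sym (*-identityˡ _))
    minOneCoeff-false∷≈row (true  ∷ e) = sym (zeroʳ 1#)

  row-∷ʳ-false : (b : Carrier) (d : List Bool) → row b (d ∷ʳ false) ≈ row b d * b
  row-∷ʳ-false b []          = *-comm b 1#
  row-∷ʳ-false b (false ∷ d) = trans (*-congˡ (row-∷ʳ-false b d)) (sym (*-assoc b _ b))
  row-∷ʳ-false b (true  ∷ d) = sym (zeroˡ b)

  row-∷ʳ-true : (b : Carrier) (d : List Bool) → row b (d ∷ʳ true) ≈ 0#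
  row-∷ʳ-true b []          = refl
  row-∷ʳ-true b (false ∷ d) = trans (*-congˡ (row-∷ʳ-true b d)) (zeroʳ b)
  row-∷ʳ-true b (true  ∷ d) = refl

  row-reverse : (b : Carrier) (d : List Bool) → row b (reverse d) ≈ row b d
  row-reverse b []          = refl
  row-reverse b (false ∷ d) = begin
    row b (reverse (false ∷ d))   ≡⟨ cong (row b) (unfold-reverse false d) ⟩
    row b (reverse d ∷ʳ false)    ≈⟨ row-∷ʳ-false b (reverse d) ⟩
    row b (reverse d) * b         ≈⟨ *-congʳ (row-reverse b d) ⟩
    row b d * b                   ≈⟨ *-comm _ b ⟩
    b * row b d                   ∎
  row-reverse b (true  ∷ d) =
    trans (reflexive (cong (row b) (unfold-reverse true d))) (row-∷ʳ-true b (reverse d))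

  hook-∷ʳ-false : (a b : Carrier) (d : List Bool) → hook a b (d ∷ʳ false) ≈ hook a b d * b
  hook-∷ʳ-false a b []          = *-comm b 1#
  hook-∷ʳ-false a b (true  ∷ d) = trans (*-congˡ (hook-∷ʳ-false a b d)) (sym (*-assoc a _ b))
  hook-∷ʳ-false a b (false ∷ d) = row-∷ʳ-false b (false ∷ d)

  hook-∷ʳ-true : (a b : Carrier) (d : List Bool) → hook a b (d ∷ʳ true) ≈ row a (map not d) * a
  hook-∷ʳ-true a b []          = *-comm a 1#
  hook-∷ʳ-true a b (true  ∷ d) = trans (*-congˡ (hook-∷ʳ-true a b d)) (sym (*-assoc a _ a))
  hook-∷ʳ-true a b (false ∷ d) =
    trans (trans (*-congˡ (row-∷ʳ-true b d)) (zeroʳ b)) (sym (zeroˡ a))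

  hook-reverse : (a b : Carrier) (d : List Bool) → hook a b (reverse d) ≈ hook b a (map not d)
  hook-reverse a b []          = refl
  hook-reverse a b (false ∷ d) = begin
    hook a b (reverse (false ∷ d))   ≡⟨ cong (hook a b) (unfold-reverse false d) ⟩
    hook a b (reverse d ∷ʳ false)    ≈⟨ hook-∷ʳ-false a b (reverse d) ⟩
    hook a b (reverse d) * b         ≈⟨ *-congʳ (hook-reverse a b d) ⟩
    hook b a (map not d) * b         ≈⟨ *-comm _ b ⟩
    b * hook b a (map not d)         ∎
  hook-reverse a b (true  ∷ d) = begin
    hook a b (reverse (true ∷ d))    ≡⟨ cong (hook a b) (unfold-reverse true d) ⟩
    hook a b (reverse d ∷ʳ true)     ≈⟨ hook-∷ʳ-true a b (reverse d) ⟩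
    row a (map not (reverse d)) * a  ≡⟨ cong (λ e → row a e * a) (reverse-map not d) ⟩
    row a (reverse (map not d)) * a  ≈⟨ *-congʳ (row-reverse a (map not d)) ⟩
    row a (map not d) * a            ≈⟨ *-comm _ a ⟩
    a * row a (map not d)            ∎

  maxOneCoeff≈hook : (d : List Bool) → maxOneCoeff R d ≈ hook 1# (- 1#) (map not d)
  maxOneCoeff≈hook d = trans (minOneCoeff≈hook (reverse d)) (hook-reverse (- 1#) 1# d)

  ShuffleVanishing : (List Bool → Carrier) → Set ℓ
  ShuffleVanishing φ = (p : Bool) (ps : List Bool) (q : Bool) (qs : List Bool) →
                       ∑ (φ ∘ Des) (shuffles (lower (p ∷ ps)) (upper (q ∷ qs))) ≈ 0#

  module HookShuffles (a b : Carrier) where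

    H T : List Letter → Carrier
    H w = hook a b (Des w)
    T w = row b (Des w)

    Sh : List Bool → List Bool → List (List Letter)
    Sh ps qs = shuffles (lower ps) (upper qs)

    ∑-Sh-∷ : (h : List Letter → Carrier) (p : Bool) (ps : List Bool) (q : Bool) (qs : List Bool) →
             ∑ h (Sh (p ∷ ps) (q ∷ qs))
             ≈ ∑ (h ∘ ((false , p) ∷_)) (Sh ps (q ∷ qs)) + ∑ (h ∘ ((true , q) ∷_)) (Sh (p ∷ ps) qs)
    ∑-Sh-∷ h p ps q qs = ∑-shuffles-∷ h (false , p) (lower ps) (true , q) (upper qs)

    ∑-Sh-∷-lower : (h : List Letter → Carrier) (p : Bool) (ps : List Bool) (q : Bool) (qs : List Bool) →
                   ∑ (h ∘ ((true , q) ∷_)) (Sh (p ∷ ps) qs) ≈ 0# →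
                   ∑ h (Sh (p ∷ ps) (q ∷ qs)) ≈ ∑ (h ∘ ((false , p) ∷_)) (Sh ps (q ∷ qs))
    ∑-Sh-∷-lower h p ps q qs upper≈0 =
      trans (∑-Sh-∷ h p ps q qs) (trans (+-congˡ upper≈0) (+-identityʳ _))

    x*[b*yz]≈b*[xy*z] : (x y z : Carrier) → x * (b * (y * z)) ≈ b * ((x * y) * z)
    x*[b*yz]≈b*[xy*z] x y z = trans (x∙yz≈y∙xz x b _) (*-congˡ (sym (*-assoc x y z)))

    -- Termwise zero: such a shuffle has a descent where the smaller word's first letter appears.
    row-shuffles-upper-first : (f p : Bool) (ps qs : List Bool) →
                               ∑ (T ∘ ((true , f) ∷_)) (Sh (p ∷ ps) qs) ≈ 0#
    row-shuffles-upper-first f     p ps []       = +-identityʳ 0#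
    row-shuffles-upper-first true  p ps (q ∷ qs) =
      trans (∑-Sh-∷-lower (T ∘ ((true , true) ∷_)) p ps q qs (∑-vanishes (λ _ → refl) (Sh (p ∷ ps) qs)))
            (∑-vanishes (λ _ → refl) (Sh ps (q ∷ qs)))
    row-shuffles-upper-first false p ps (q ∷ qs) =
      trans (∑-Sh-∷ (T ∘ ((true , false) ∷_)) p ps q qs)
            (trans (+-cong (∑-vanishes (λ _ → refl) (Sh ps (q ∷ qs)))
                           (∑-scale-vanishes b (T ∘ ((true , q) ∷_)) (Sh (p ∷ ps) qs)
                                             (row-shuffles-upper-first q p ps qs)))
                   (+-identityʳ 0#))

    b*row-shuffles-upper-first : (f p : Bool) (ps qs : List Bool) →
                                 ∑ (λ w → b * T ((true , f) ∷ w)) (Sh (p ∷ ps) qs) ≈ 0#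
    b*row-shuffles-upper-first f p ps qs =
      ∑-scale-vanishes b (T ∘ ((true , f) ∷_)) (Sh (p ∷ ps) qs) (row-shuffles-upper-first f p ps qs)

    row-shuffles-lower-first : (f : Bool) (ps : List Bool) (q : Bool) (qs : List Bool) →
      ∑ (T ∘ ((false , f) ∷_)) (Sh ps (q ∷ qs)) ≈ b * (T (lower (f ∷ ps)) * T (upper (q ∷ qs)))
    row-shuffles-lower-first f     []       q qs =
      trans (+-identityʳ _) (*-congˡ (sym (*-identityˡ _)))
    row-shuffles-lower-first true  (p ∷ ps) q qs =
      trans (∑-Sh-∷-lower (T ∘ ((false , true) ∷_)) p ps q qs (b*row-shuffles-upper-first q p ps qs))
            (trans (∑-vanishes (λ _ → refl) (Sh ps (q ∷ qs))) (sym (trans (*-congˡ (zeroˡ _)) (zeroʳ b))))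
    row-shuffles-lower-first false (p ∷ ps) q qs =
      trans (∑-Sh-∷-lower (T ∘ ((false , false) ∷_)) p ps q qs (b*row-shuffles-upper-first q p ps qs))
            (trans (∑-scale b (T ∘ ((false , p) ∷_)) (Sh ps (q ∷ qs)) (row-shuffles-lower-first p ps q qs))
                   (x*[b*yz]≈b*[xy*z] b _ _))

    hook-shuffles-lower-first : (f : Bool) (ps : List Bool) (q : Bool) (qs : List Bool) →
      ∑ (H ∘ ((false , f) ∷_)) (Sh ps (q ∷ qs)) ≈ b * (H (lower (f ∷ ps)) * T (upper (q ∷ qs)))
    hook-shuffles-lower-first f     []       q qs =
      trans (+-identityʳ _) (*-congˡ (sym (*-identityˡ _)))
    hook-shuffles-lower-first true  (p ∷ ps) q qs =
      trans (∑-Sh-∷-lower (H ∘ ((false , true) ∷_)) p ps q qs (b*row-shuffles-upper-first q p ps qs))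
            (trans (∑-scale a (H ∘ ((false , p) ∷_)) (Sh ps (q ∷ qs)) (hook-shuffles-lower-first p ps q qs))
                   (x*[b*yz]≈b*[xy*z] a _ _))
    hook-shuffles-lower-first false (p ∷ ps) q qs =
      trans (∑-Sh-∷-lower (H ∘ ((false , false) ∷_)) p ps q qs (b*row-shuffles-upper-first q p ps qs))
            (trans (∑-scale b (T ∘ ((false , p) ∷_)) (Sh ps (q ∷ qs)) (row-shuffles-lower-first p ps q qs))
                   (x*[b*yz]≈b*[xy*z] b _ _))

    hook-shuffles-upper-first : a + b ≈ 0# → (f p : Bool) (ps qs : List Bool) →
      ∑ (H ∘ ((true , f) ∷_)) (Sh (p ∷ ps) qs) ≈ a * (H (lower (p ∷ ps)) * T (upper (f ∷ qs)))
    hook-shuffles-upper-first a+b≈0 f     p ps []       =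
      trans (+-identityʳ _) (*-congˡ (sym (*-identityʳ _)))
    hook-shuffles-upper-first a+b≈0 true  p ps (q ∷ qs) = begin
      ∑ (H ∘ ((true , true) ∷_)) (Sh (p ∷ ps) (q ∷ qs))
        ≈⟨ ∑-Sh-∷ (H ∘ ((true , true) ∷_)) p ps q qs ⟩
      ∑ (λ w → a * H ((false , p) ∷ w)) (Sh ps (q ∷ qs))
        + ∑ (λ w → a * H ((true , q) ∷ w)) (Sh (p ∷ ps) qs)
        ≈⟨ +-cong (∑-scale a (H ∘ ((false , p) ∷_)) (Sh ps (q ∷ qs))
                           (hook-shuffles-lower-first p ps q qs))
                  (∑-scale a (H ∘ ((true , q) ∷_)) (Sh (p ∷ ps) qs)
                           (hook-shuffles-upper-first a+b≈0 q p ps qs)) ⟩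
      a * (b * X) + a * (a * X)   ≈⟨ sym (distribˡ a _ _) ⟩
      a * (b * X + a * X)         ≈⟨ *-congˡ (sym (distribʳ X b a)) ⟩
      a * ((b + a) * X)           ≈⟨ *-congˡ (trans (*-congʳ (trans (+-comm b a) a+b≈0)) (zeroˡ X)) ⟩
      a * 0#                      ≈⟨ *-congˡ (sym (zeroʳ _)) ⟩
      a * (H (lower (p ∷ ps)) * T (upper (true ∷ q ∷ qs))) ∎
      where
      X : Carrier
      X = H (lower (p ∷ ps)) * T (upper (q ∷ qs))
    hook-shuffles-upper-first a+b≈0 false p ps (q ∷ qs) =
      trans (∑-Sh-∷-lower (H ∘ ((true , false) ∷_)) p ps q qs (b*row-shuffles-upper-first q p ps qs))
            (trans (∑-scale a (H ∘ ((false , p) ∷_)) (Sh ps (q ∷ qs)) (hook-shuffles-lower-first p ps q qs))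
                   (*-congˡ (x∙yz≈y∙xz b _ _)))

    hook-shuffles-vanish : a + b ≈ 0# → ShuffleVanishing (hook a b)
    hook-shuffles-vanish a+b≈0 p ps q qs = begin
      ∑ H (Sh (p ∷ ps) (q ∷ qs))
        ≈⟨ ∑-Sh-∷ H p ps q qs ⟩
      ∑ (H ∘ ((false , p) ∷_)) (Sh ps (q ∷ qs)) + ∑ (H ∘ ((true , q) ∷_)) (Sh (p ∷ ps) qs)
        ≈⟨ +-cong (hook-shuffles-lower-first p ps q qs) (hook-shuffles-upper-first a+b≈0 q p ps qs) ⟩
      b * X + a * X               ≈⟨ sym (distribʳ X b a) ⟩
      (b + a) * X                 ≈⟨ trans (*-congʳ (trans (+-comm b a) a+b≈0)) (zeroˡ X) ⟩
      0#                          ∎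
      where
      X : Carrier
      X = H (lower (p ∷ ps)) * T (upper (q ∷ qs))

  open HookShuffles using (hook-shuffles-vanish)

  minOne-shuffles-vanish : ShuffleVanishing (minOneCoeff R)
  minOne-shuffles-vanish p ps q qs =
    trans (∑-cong (minOneCoeff≈hook ∘ Des) (shuffles (lower (p ∷ ps)) (upper (q ∷ qs))))
          (hook-shuffles-vanish (- 1#) 1# (-‿inverseˡ 1#) p ps q qs)

  maxOne-shuffles-vanish : ShuffleVanishing (maxOneCoeff R)
  maxOne-shuffles-vanish p ps q qs = begin
    ∑ (maxOneCoeff R ∘ Des) (shuffles (lower (p ∷ ps)) (upper (q ∷ qs)))
      ≈⟨ ∑-cong (λ w → trans (maxOneCoeff≈hook (Des w)) (reflexive (cong φ (≡.sym (Des-complement w)))))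
                (shuffles (lower (p ∷ ps)) (upper (q ∷ qs))) ⟩
    ∑ (φ ∘ Des ∘ map complement) (shuffles (lower (p ∷ ps)) (upper (q ∷ qs)))
      ≈⟨ sym (∑-shuffles-map (φ ∘ Des) complement (lower (p ∷ ps)) (upper (q ∷ qs))) ⟩
    ∑ (φ ∘ Des) (shuffles (map complement (lower (p ∷ ps))) (map complement (upper (q ∷ qs))))
      ≡⟨ cong₂ (λ xs ys → ∑ (φ ∘ Des) (shuffles xs ys))
               (complement-lower (p ∷ ps)) (complement-upper (q ∷ qs)) ⟩
    ∑ (φ ∘ Des) (shuffles (upper (map not (p ∷ ps))) (lower (map not (q ∷ qs))))
      ≈⟨ ∑-shuffles-comm (φ ∘ Des) (upper (map not (p ∷ ps))) (lower (map not (q ∷ qs))) ⟩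
    ∑ (φ ∘ Des) (shuffles (lower (map not (q ∷ qs))) (upper (map not (p ∷ ps))))
      ≈⟨ hook-shuffles-vanish 1# (- 1#) (-‿inverseʳ 1#) (not q) (map not qs) (not p) (map not ps) ⟩
    0# ∎
    where
    φ : List Bool → Carrier
    φ = hook 1# (- 1#)

  wordShuffles-vanish : (φ : List Bool → Carrier) → ShuffleVanishing φ →
                        {n m : ℕ} (S : Comp n) (T : Comp m) → ∑ (φ ∘ Des) (wordShuffles S T) ≈ 0#
  wordShuffles-vanish φ v V.[]       V.[]       = v false [] false []
  wordShuffles-vanish φ v V.[]       (y V.∷ T)  = v false [] y (toList T ∷ʳ false)
  wordShuffles-vanish φ v (x V.∷ S)  V.[]       = v x (toList S ∷ʳ false) false []
  wordShuffles-vanish φ v (x V.∷ S)  (y V.∷ T)  = v x (toList S ∷ʳ false) y (toList T ∷ʳ false)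

  δ : List Bool → List Bool → Carrier
  δ d e = if does (≡-dec _≟B_ d e) then 1# else 0#

  pairing : (List Bool → Carrier) → {K : ℕ} → Hom R K → Carrier
  pairing φ {K} h = ∑ (λ U → φ (toList U) * h U) (allComp K)

  pairing-cong : (φ : List Bool → Carrier) {K : ℕ} {h k : Hom R K} → (∀ U → h U ≈ k U) →
                 pairing φ h ≈ pairing φ k
  pairing-cong φ {K} e = ∑-cong (λ U → *-congˡ (e U)) (allComp K)

  pairing-∑ : (φ : List Bool → Carrier) {K : ℕ} (h : A → Hom R K) (l : List A) →
              pairing φ (λ U → ∑ (λ i → h i U) l) ≈ ∑ (λ i → pairing φ (h i)) l
  pairing-∑ φ {K} h l =
    trans (∑-cong (λ U → *-∑ (φ (toList U)) (λ i → h i U) l) (allComp K))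
          (∑-comm (λ U i → φ (toList U) * h i U) (allComp K) l)

  pairing-scale : (φ : List Bool → Carrier) {K : ℕ} (x : Carrier) (h : Hom R K) →
                  pairing φ (λ U → x * h U) ≈ x * pairing φ h
  pairing-scale φ {K} x h =
    trans (∑-cong (λ U → x∙yz≈y∙xz (φ (toList U)) x (h U)) (allComp K)) (sym (*-∑ x _ (allComp K)))

  pairing-suc : (φ : List Bool → Carrier) {K : ℕ} (h : Hom R (suc K)) →
                pairing φ h ≈ pairing (φ ∘ (true ∷_)) (h ∘ (true V.∷_))
                              + pairing (φ ∘ (false ∷_)) (h ∘ (false V.∷_))
  pairing-suc φ {K} h =
    trans (∑-++ _ (map (true V.∷_) (allComp K)) (map (false V.∷_) (allComp K)))
          (reflexive (cong₂ _+_ (∑-map _ (true V.∷_) (allComp K)) (∑-map _ (false V.∷_) (allComp K))))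

  pairing-δ : (φ : List Bool → Carrier) {K : ℕ} (d : List Bool) → length d ≡ K →
              pairing φ {K} (δ d ∘ toList) ≈ φ d
  pairing-δ φ {zero}  []          ≡.refl = trans (+-identityʳ _) (*-identityʳ _)
  pairing-δ φ {suc K} (true  ∷ d) eq     =
    trans (pairing-suc φ {K} (δ (true ∷ d) ∘ toList))
          (trans (+-cong (pairing-δ (φ ∘ (true ∷_)) d (ℕ.suc-injective eq))
                         (∑-vanishes (λ _ → zeroʳ _) (allComp K)))
                 (+-identityʳ _))
  pairing-δ φ {suc K} (false ∷ d) eq     =
    trans (pairing-suc φ {K} (δ (false ∷ d) ∘ toList))
          (trans (+-cong (∑-vanishes (λ _ → zeroʳ _) (allComp K))
                         (pairing-δ (φ ∘ (false ∷_)) d (ℕ.suc-injective eq)))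
                 (+-identityˡ _))

  L-product : {n m : ℕ} → Comp n → Comp m → Hom R (suc (n +ℕ m))
  L-product S T U = ∑ (λ w → δ (Des w) (toList U)) (wordShuffles S T)

  pairing-L-product : (φ : List Bool → Carrier) {n m : ℕ} (S : Comp n) (T : Comp m) →
                      pairing φ (L-product S T) ≈ ∑ (φ ∘ Des) (wordShuffles S T)
  pairing-L-product φ {n} {m} S T =
    trans (pairing-∑ φ {suc (n +ℕ m)} (λ w → δ (Des w) ∘ toList) (wordShuffles S T))
          (∑-congᴬ (All.map (pairing-δ φ _) (Des-wordShuffles-length S T)))

  -- The left-hand side is the local coefficient function of mul, which has no name
  -- outside Defs; it is inferred from the use in mul-expansion below.
  mul-coefficient : {n m : ℕ} (f : Hom R n) (g : Hom R m) (U : Comp (suc (n +ℕ m)))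
                    (S : Comp n) (T : Comp m) (w : List Letter) →
                    _ ≈ (f S * g T) * δ (Des w) (toList U)

  mul-expansion : {n m : ℕ} (f : Hom R n) (g : Hom R m) (U : Comp (suc (n +ℕ m))) →
    mul R f g U ≈ ∑ (λ S → ∑ (λ T → (f S * g T) * L-product S T U) (allComp m)) (allComp n)
  mul-expansion {n} {m} f g U =
    trans (sumR-concatMap _ (allComp n)) (∑-cong (λ S →
      trans (sumR-concatMap _ (allComp m)) (∑-cong (λ T →
        trans (∑-cong (mul-coefficient f g U S T) (wordShuffles S T))
              (sym (*-∑ (f S * g T) (λ w → δ (Des w) (toList U)) (wordShuffles S T))))
      (allComp m))) (allComp n))

  mul-coefficient f g U S T w with ≡-dec _≟B_ (Des w) (toList U)
  ... | yes _ = sym (*-identityʳ _)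
  ... | no  _ = sym (zeroʳ _)

  pairing-mul : (φ : List Bool → Carrier) {n m : ℕ} (f : Hom R n) (g : Hom R m) →
    pairing φ (mul R f g)
    ≈ ∑ (λ S → ∑ (λ T → (f S * g T) * ∑ (φ ∘ Des) (wordShuffles S T)) (allComp m)) (allComp n)
  pairing-mul φ {n} {m} f g = begin
    pairing φ (mul R f g)
      ≈⟨ pairing-cong φ (mul-expansion f g) ⟩
    pairing φ {K} (λ U → ∑ (λ S → ∑ (λ T → (f S * g T) * L-product S T U) (allComp m)) (allComp n))
      ≈⟨ pairing-∑ φ {K} _ (allComp n) ⟩
    ∑ (λ S → pairing φ {K} (λ U → ∑ (λ T → (f S * g T) * L-product S T U) (allComp m))) (allComp n)
      ≈⟨ ∑-cong (λ S → trans (pairing-∑ φ {K} _ (allComp m))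
                             (∑-cong (λ T → pairing-scale φ (f S * g T) (L-product S T)) (allComp m)))
                (allComp n) ⟩
    ∑ (λ S → ∑ (λ T → (f S * g T) * pairing φ (L-product S T)) (allComp m)) (allComp n)
      ≈⟨ ∑-cong (λ S → ∑-cong (λ T → *-congˡ (pairing-L-product φ S T)) (allComp m)) (allComp n) ⟩
    ∑ (λ S → ∑ (λ T → (f S * g T) * ∑ (φ ∘ Des) (wordShuffles S T)) (allComp m)) (allComp n) ∎
    where
    K : ℕ
    K = suc (n +ℕ m)

  pairing-mul-vanishes : (φ : List Bool → Carrier) → ShuffleVanishing φ →
                         {n m : ℕ} (f : Hom R n) (g : Hom R m) → pairing φ (mul R f g) ≈ 0#
  pairing-mul-vanishes φ v {n} {m} f g =
    trans (pairing-mul φ f g)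
          (∑-vanishes (λ S → ∑-vanishes (λ T →
            trans (*-congˡ (wordShuffles-vanish φ v S T)) (zeroʳ _)) (allComp m)) (allComp n))

lemma3p1 : {c ℓ : Level} (R : CommutativeRing c ℓ) (n m : ℕ)
           (f : Hom R n) (g : Hom R m) →
           CommutativeRing._≈_ R (MinOne R (mul R f g)) (CommutativeRing.0# R)
           × CommutativeRing._≈_ R (MaxOne R (mul R f g)) (CommutativeRing.0# R)
lemma3p1 R n m f g =
  pairing-mul-vanishes R (minOneCoeff R) (minOne-shuffles-vanish R) f g ,
  pairing-mul-vanishes R (maxOneCoeff R) (maxOne-shuffles-vanish R) f g
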